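{- Let $\pi$ be a Motzkin path of length $N$ satisfying the red–blue rule, and let $h(x)$ denote the height of $\pi$ at abscissa $x\in\{0,1,\dots,N\}$. Then the set $\{(x,y)\in\mathbb Z^2:0\le x\le N,\ 0\le y<h(x)\}$ of lattice points strictly below $\pi$ with $y\ge0$ contains equally many points with $x+y$ odd as points with $x+y$ even.
   Context: A Motzkin path of length $N$ is a lattice path from $(0,0)$ to $(N,0)$ consisting of steps $U=(1,1)$, $D=(1,-1)$, $H=(1,0)$ that never goes below the line $y=0$. Each step $s$ is colored blue if the number of $H$ steps among the steps up to and including $s$ is even, and red otherwise. The path satisfies the red–blue rule if for every $i$, among the first $i$ steps, (1) the number of red $D$ steps is at most the number of blue $U$ steps, and (2) the number of blue $D$ steps is at most the number of red $U$ steps. -}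

module Defs where

open import Data.Nat using (ℕ; zero; suc; _+_; _≤_; _<_)
open import Data.Nat.Properties using (_≤?_)
open import Data.Integer as ℤ using (ℤ; +_; -[1+_]; +[1+_])
open import Data.Bool using (Bool; true; false; not; if_then_else_)
open import Data.List using (List; []; _∷_; length; take)
open import Data.Product using (_×_; _,_)
open import Relation.Binary.PropositionalEquality using (_≡_)

-- Steps U = (1,1), D = (1,-1), H = (1,0).
data Step : Set where
  U D H : Step

Path : Set
Path = List Step

δ : Step → ℤ
δ U = + 1
δ D = -[1+ 0 ]
δ H = + 0

endHeight : Path → ℤ
endHeight []       = + 0
endHeight (s ∷ ss) = δ s ℤ.+ endHeight ss

height : Path → ℕ → ℤ
height π x = endHeight (take x π)

IsMotzkin : Path → Set
IsMotzkin π = (∀ x → x ≤ length π → + 0 ℤ.≤ height π x) × (endHeight π ≡ + 0)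

-- Colours: a step is blue if the number of H steps among the steps up to
-- and including it is even, red otherwise.
data Colour : Set where
  blue red : Colour

oddH : Path → Bool
oddH []       = false
oddH (U ∷ ss) = oddH ss
oddH (D ∷ ss) = oddH ss
oddH (H ∷ ss) = not (oddH ss)

colourAt : Path → ℕ → Colour
colourAt π i = if oddH (take (suc i) π) then red else blue

stepAt : Path → ℕ → Step
stepAt []       _       = H
stepAt (s ∷ ss) zero    = s
stepAt (s ∷ ss) (suc i) = stepAt ss i

countUpTo : (Step → Colour → Bool) → Path → ℕ → ℕ
countUpTo p π zero    = 0
countUpTo p π (suc i) =
  (if p (stepAt π i) (colourAt π i) then 1 else 0) + countUpTo p π i

isRedD isBlueU isBlueD isRedU : Step → Colour → Bool
isRedD D red = true
isRedD _ _ = false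
isBlueU U blue = true
isBlueU _ _ = false
isBlueD D blue = true
isBlueD _ _ = false
isRedU U red = true
isRedU _ _ = false

RedBlueRule : Path → Set
RedBlueRule π = ∀ i → i ≤ length π →
  (countUpTo isRedD π i ≤ countUpTo isBlueU π i) ×
  (countUpTo isBlueD π i ≤ countUpTo isRedU π i)

odd : ℕ → Bool
odd zero    = false
odd (suc n) = not (odd n)

countCol : Bool → ℕ → ℕ → ℕ
countCol b x zero    = 0
countCol b x (suc y) = (if (odd (x + y) Data.Bool.∧ b) Data.Bool.∨
                           (not (odd (x + y)) Data.Bool.∧ not b) then 1 else 0)
                       + countCol b x y

colPoints : Bool → ℕ → ℤ → ℕ
colPoints b x (+ h)     = countCol b x h
colPoints b x -[1+ _ ]  = 0

pointsUpTo : Bool → Path → ℕ → ℕ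
pointsUpTo b π zero    = colPoints b 0 (height π 0)
pointsUpTo b π (suc x) = colPoints b (suc x) (height π (suc x)) + pointsUpTo b π x

pointsBelow : Bool → Path → ℕ
pointsBelow b π = pointsUpTo b π (length π)

module Submission where

open import Defs
open import Relation.Binary.PropositionalEquality using (_≡_)
open import Data.Bool using (true; false)

open import Data.Bool using (Bool; not; _∧_; _∨_; _xor_; if_then_else_)
open import Data.Bool.Properties using (not-distribˡ-xor; xor-assoc; xor-identityʳ)
open import Data.Integer using (ℤ; +_; _+_; 0ℤ; 1ℤ; -1ℤ; _-_; _*_; -_; ∣_∣)
open import Data.Integer.Properties as ℤ using (pos-+; +-injective; i-j≡0⇒i≡j; *-cancelˡ-≡; 0≤i⇒+∣i∣≡i)
open import Data.Integer.Tactic.RingSolver using (solve-∀)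
open import Data.List using (List; []; _∷_; length; take)
open import Data.List.Properties using (take-all)
open import Data.Nat as ℕ using (ℕ; zero; suc; _≤_; _<_; s≤s)
open import Data.Nat.Properties as ℕ using (≤-refl; <⇒≤; <⇒≢; +-comm; +-identityʳ; +-mono-<-≤; m≤n⇒m<n∨m≡n; +-cancelˡ-≡)
open import Data.Product using (_×_; _,_; proj₁; proj₂)
open import Data.Sum using (inj₁; inj₂)
open import Relation.Binary.PropositionalEquality using (refl; sym; trans; cong; cong₂; subst; module ≡-Reasoning)
open import Relation.Nullary using (contradiction)

-- Let h(x) be the height of π at x and e(x) the parity of the number of H steps among the
-- first x steps; a step ending at x is red iff e(x) = 1, and x ≡ e(x) + h(x) (mod 2).
-- Column x is balanced if h(x) is even; otherwise it has one odd point more than even points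
-- if e(x) = 0 and one fewer if e(x) = 1.
-- A U or D step joins a column of odd height to one of even height, both of its own colour,
-- while an H step joins two columns of equal height and opposite colours. Hence, up to column n,
--   2 (#odd − #even) = (#blue − #red among the U, D steps) + [h(n) odd] (−1)^e(n).
-- At the end h = 0, and #U = #D together with the red–blue rule forces #red D = #blue U and
-- #blue D = #red U, so the right-hand side vanishes.

isH : Step → Bool
isH H = true
isH _ = false

⟦_⟧ : Bool → ℤ
⟦ b ⟧ = + (if b then 1 else 0)

sign : Bool → ℤ
sign false = 1ℤ
sign true  = -1ℤ

colourOf : Bool → Colour
colourOf e = if e then red else blue

weight : Step → Colour → ℤ
weight s c = (⟦ isBlueU s c ⟧ + ⟦ isBlueD s c ⟧) - (⟦ isRedU s c ⟧ + ⟦ isRedD s c ⟧)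

data _⟶⟨_⟩_ : ℕ → Step → ℕ → Set where
  up   : ∀ {k} → k ⟶⟨ U ⟩ suc k
  down : ∀ {k} → suc k ⟶⟨ D ⟩ k
  flat : ∀ {k} → k ⟶⟨ H ⟩ k

step-from-δ : ∀ s {k k'} → + k' ≡ + k + δ s → k ⟶⟨ s ⟩ k'
step-from-δ U {k} eq rewrite +-injective eq | +-comm k 1 = up
step-from-δ D {suc k} refl = down
step-from-δ H {k} eq rewrite +-injective eq | +-identityʳ k = flat

height-suc : ∀ π n → height π (suc n) ≡ height π n + δ (stepAt π n)
height-suc []       zero    = refl
height-suc []       (suc n) = refl
height-suc (s ∷ ss) zero    = trans (ℤ.+-identityʳ (δ s)) (sym (ℤ.+-identityˡ (δ s)))
height-suc (s ∷ ss) (suc n) =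
  trans (cong (λ z → δ s + z) (height-suc ss n)) (sym (ℤ.+-assoc (δ s) _ _))

oddH-∷ : ∀ s ss → oddH (s ∷ ss) ≡ isH s xor oddH ss
oddH-∷ U ss = refl
oddH-∷ D ss = refl
oddH-∷ H ss = refl

oddH-take-suc : ∀ π n → n < length π →
  oddH (take (suc n) π) ≡ oddH (take n π) xor isH (stepAt π n)
oddH-take-suc (s ∷ ss) zero    _ = trans (oddH-∷ s []) (xor-identityʳ (isH s))
oddH-take-suc (s ∷ ss) (suc n) (s≤s n<len) = begin
  oddH (s ∷ take (suc n) ss)                ≡⟨ oddH-∷ s _ ⟩
  isH s xor oddH (take (suc n) ss)          ≡⟨ cong (isH s xor_) (oddH-take-suc ss n n<len) ⟩
  isH s xor (oddH (take n ss) xor _)        ≡⟨ sym (xor-assoc (isH s) _ _) ⟩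
  (isH s xor oddH (take n ss)) xor _        ≡⟨ cong (_xor isH (stepAt ss n)) (sym (oddH-∷ s _)) ⟩
  oddH (s ∷ take n ss) xor isH (stepAt ss n) ∎
  where open ≡-Reasoning

diff-of-sums : ∀ a b c d → (a + c) - (b + d) ≡ (a - b) + (c - d)
diff-of-sums = solve-∀

odd-+ : ∀ m n → odd (m ℕ.+ n) ≡ odd m xor odd n
odd-+ zero    n = refl
odd-+ (suc m) n = trans (cong not (odd-+ m n)) (not-distribˡ-xor (odd m) (odd n))

countCol-balance : ∀ x k →
  + countCol true x k - + countCol false x k ≡ ⟦ odd k ⟧ * sign (odd x xor odd k)
countCol-balance x zero    = refl
countCol-balance x (suc k) = begin
  + (oddPt ℕ.+ countCol true x k) - + (evenPt ℕ.+ countCol false x k)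
    ≡⟨ cong₂ _-_ (pos-+ oddPt _) (pos-+ evenPt _) ⟩
  (+ oddPt + + countCol true x k) - (+ evenPt + + countCol false x k)
    ≡⟨ diff-of-sums (+ oddPt) (+ evenPt) (+ countCol true x k) (+ countCol false x k) ⟩
  (+ oddPt - + evenPt) + (+ countCol true x k - + countCol false x k)
    ≡⟨ cong₂ _+_ (new-point (odd (x ℕ.+ k))) (countCol-balance x k) ⟩
  - sign (odd (x ℕ.+ k)) + ⟦ odd k ⟧ * sign (odd x xor odd k)
    ≡⟨ cong (λ b → - sign b + ⟦ odd k ⟧ * sign (odd x xor odd k)) (odd-+ x k) ⟩
  - sign (odd x xor odd k) + ⟦ odd k ⟧ * sign (odd x xor odd k)
    ≡⟨ add-row (odd x) (odd k) ⟩
  ⟦ not (odd k) ⟧ * sign (odd x xor not (odd k)) ∎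
  where
  open ≡-Reasoning
  oddPt evenPt : ℕ
  oddPt  = if (odd (x ℕ.+ k) ∧ true) ∨ (not (odd (x ℕ.+ k)) ∧ false) then 1 else 0
  evenPt = if (odd (x ℕ.+ k) ∧ false) ∨ (not (odd (x ℕ.+ k)) ∧ true) then 1 else 0
  new-point : ∀ o → ⟦ (o ∧ true) ∨ (not o ∧ false) ⟧ - ⟦ (o ∧ false) ∨ (not o ∧ true) ⟧ ≡ - sign o
  new-point true  = refl
  new-point false = refl
  add-row : ∀ p o → - sign (p xor o) + ⟦ o ⟧ * sign (p xor o) ≡ ⟦ not o ⟧ * sign (p xor not o)
  add-row true  true  = refl
  add-row true  false = refl
  add-row false true  = refl
  add-row false false = refl

parity-step : ∀ n {k s k'} → k ⟶⟨ s ⟩ k' →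
  (odd n xor odd k) xor isH s ≡ odd (suc n) xor odd k'
parity-step n (up {k}) with odd n | odd k
... | true  | true  = refl
... | true  | false = refl
... | false | true  = refl
... | false | false = refl
parity-step n (down {k}) with odd n | odd k
... | true  | true  = refl
... | true  | false = refl
... | false | true  = refl
... | false | false = refl
parity-step n (flat {k}) with odd n | odd k
... | true  | true  = refl
... | true  | false = refl
... | false | true  = refl
... | false | false = refl

odd-columns-step : ∀ e {k s k'} → k ⟶⟨ s ⟩ k' →
  ⟦ odd k ⟧ * sign e + ⟦ odd k' ⟧ * sign (e xor isH s) ≡ weight s (colourOf (e xor isH s))
odd-columns-step true  (up {k})   with odd k
... | true  = refl
... | false = refl
odd-columns-step false (up {k})   with odd k
... | true  = refl
... | false = refl
odd-columns-step true  (down {k}) with odd k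
... | true  = refl
... | false = refl
odd-columns-step false (down {k}) with odd k
... | true  = refl
... | false = refl
odd-columns-step true  (flat {k}) with odd k
... | true  = refl
... | false = refl
odd-columns-step false (flat {k}) with odd k
... | true  = refl
... | false = refl

+-≡-with-≤⇒≡ : ∀ {a b c d} → a ℕ.+ b ≡ c ℕ.+ d → a ≤ c → b ≤ d → a ≡ c × b ≡ d
+-≡-with-≤⇒≡ {a} {b} {c} {d} a+b≡c+d a≤c b≤d with m≤n⇒m<n∨m≡n a≤c
... | inj₁ a<c = contradiction a+b≡c+d (<⇒≢ (+-mono-<-≤ a<c b≤d))
... | inj₂ refl = refl , +-cancelˡ-≡ a b d a+b≡c+d

module CountsAlong (π : Path) where

  # : (Step → Colour → Bool) → ℕ → ℤ
  # p n = + countUpTo p π n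

  #-suc : ∀ p n → # p (suc n) ≡ ⟦ p (stepAt π n) (colourAt π n) ⟧ + # p n
  #-suc p n = pos-+ (if p (stepAt π n) (colourAt π n) then 1 else 0) (countUpTo p π n)

  rise : ℕ → ℤ
  rise n = (# isBlueU n + # isRedU n) - (# isRedD n + # isBlueD n)

  imbalance : ℕ → ℤ
  imbalance n = (# isBlueU n + # isBlueD n) - (# isRedU n + # isRedD n)

  height≡rise : ∀ n → height π n ≡ rise n
  height≡rise zero    = refl
  height≡rise (suc n) = begin
    height π (suc n)
      ≡⟨ height-suc π n ⟩
    height π n + δ s
      ≡⟨ cong₂ _+_ (height≡rise n) (δ-counts s (colourAt π n)) ⟩
    rise n + ((⟦ bu ⟧ + ⟦ ru ⟧) - (⟦ rd ⟧ + ⟦ bd ⟧))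
      ≡⟨ collect ⟦ bu ⟧ ⟦ ru ⟧ ⟦ rd ⟧ ⟦ bd ⟧ (# isBlueU n) (# isRedU n) (# isRedD n) (# isBlueD n) ⟩
    (((⟦ bu ⟧ + # isBlueU n) + (⟦ ru ⟧ + # isRedU n))
      - ((⟦ rd ⟧ + # isRedD n) + (⟦ bd ⟧ + # isBlueD n)))
      ≡⟨ sym (cong₂ _-_ (cong₂ _+_ (#-suc isBlueU n) (#-suc isRedU n))
                         (cong₂ _+_ (#-suc isRedD n) (#-suc isBlueD n))) ⟩
    rise (suc n) ∎
    where
    open ≡-Reasoning
    s : Step
    s = stepAt π n
    bu ru rd bd : Bool
    bu = isBlueU s (colourAt π n)
    ru = isRedU s (colourAt π n)
    rd = isRedD s (colourAt π n)
    bd = isBlueD s (colourAt π n)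
    δ-counts : ∀ s c → δ s ≡ (⟦ isBlueU s c ⟧ + ⟦ isRedU s c ⟧) - (⟦ isRedD s c ⟧ + ⟦ isBlueD s c ⟧)
    δ-counts U blue = refl
    δ-counts U red  = refl
    δ-counts D blue = refl
    δ-counts D red  = refl
    δ-counts H blue = refl
    δ-counts H red  = refl
    collect : ∀ a b c d a' b' c' d' →
      ((a' + b') - (c' + d')) + ((a + b) - (c + d))
        ≡ ((a + a') + (b + b')) - ((c + c') + (d + d'))
    collect = solve-∀

  imbalance-suc : ∀ n → imbalance (suc n) ≡ weight (stepAt π n) (colourAt π n) + imbalance n
  imbalance-suc n = begin
    imbalance (suc n)
      ≡⟨ cong₂ _-_ (cong₂ _+_ (#-suc isBlueU n) (#-suc isBlueD n))
                   (cong₂ _+_ (#-suc isRedU n) (#-suc isRedD n)) ⟩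
    ((⟦ bu ⟧ + # isBlueU n) + (⟦ bd ⟧ + # isBlueD n)) - ((⟦ ru ⟧ + # isRedU n) + (⟦ rd ⟧ + # isRedD n))
      ≡⟨ separate ⟦ bu ⟧ ⟦ bd ⟧ ⟦ ru ⟧ ⟦ rd ⟧ (# isBlueU n) (# isBlueD n) (# isRedU n) (# isRedD n) ⟩
    weight (stepAt π n) (colourAt π n) + imbalance n ∎
    where
    open ≡-Reasoning
    bu bd ru rd : Bool
    bu = isBlueU (stepAt π n) (colourAt π n)
    bd = isBlueD (stepAt π n) (colourAt π n)
    ru = isRedU (stepAt π n) (colourAt π n)
    rd = isRedD (stepAt π n) (colourAt π n)
    separate : ∀ a b c d a' b' c' d' →
      ((a + a') + (b + b')) - ((c + c') + (d + d')) ≡ ((a + b) - (c + d)) + ((a' + b') - (c' + d'))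
    separate = solve-∀

  imbalance-vanishes : ∀ n → RedBlueRule π → n ≤ length π → height π n ≡ 0ℤ → imbalance n ≡ 0ℤ
  imbalance-vanishes n rule n≤N height≡0 = begin
    (# isBlueU n + # isBlueD n) - (# isRedU n + # isRedD n)
      ≡⟨ cong₂ (λ a b → (+ a + + b) - (# isRedU n + # isRedD n)) (sym rd≡bu) bd≡ru ⟩
    (# isRedD n + # isRedU n) - (# isRedU n + # isRedD n)
      ≡⟨ swap-cancels (# isRedD n) (# isRedU n) ⟩
    0ℤ ∎
    where
    open ≡-Reasoning
    downs≡ups : countUpTo isRedD π n ℕ.+ countUpTo isBlueD π n ≡ countUpTo isBlueU π n ℕ.+ countUpTo isRedU π n
    downs≡ups = +-injective (begin
      + (countUpTo isRedD π n ℕ.+ countUpTo isBlueD π n) ≡⟨ pos-+ (countUpTo isRedD π n) (countUpTo isBlueD π n) ⟩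
      # isRedD n + # isBlueD n                         ≡⟨ sym (i-j≡0⇒i≡j _ _ (trans (sym (height≡rise n)) height≡0)) ⟩
      # isBlueU n + # isRedU n                         ≡⟨ sym (pos-+ (countUpTo isBlueU π n) (countUpTo isRedU π n)) ⟩
      + (countUpTo isBlueU π n ℕ.+ countUpTo isRedU π n) ∎)
    rd≡bu : countUpTo isRedD π n ≡ countUpTo isBlueU π n
    rd≡bu = proj₁ (+-≡-with-≤⇒≡ downs≡ups (proj₁ (rule n n≤N)) (proj₂ (rule n n≤N)))
    bd≡ru : countUpTo isBlueD π n ≡ countUpTo isRedU π n
    bd≡ru = proj₂ (+-≡-with-≤⇒≡ downs≡ups (proj₁ (rule n n≤N)) (proj₂ (rule n n≤N)))
    swap-cancels : ∀ a b → (a + b) - (b + a) ≡ 0ℤ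
    swap-cancels = solve-∀

module AlongMotzkinPath (π : Path) (motzkin : IsMotzkin π) where

  open CountsAlong π

  h : ℕ → ℕ
  h n = ∣ height π n ∣

  colourParity : ℕ → Bool
  colourParity n = oddH (take n π)

  height≡h : ∀ {n} → n ≤ length π → height π n ≡ + h n
  height≡h n≤N = sym (0≤i⇒+∣i∣≡i (proj₁ motzkin _ n≤N))

  h-step : ∀ {n} → n < length π → h n ⟶⟨ stepAt π n ⟩ h (suc n)
  h-step {n} n<N = step-from-δ (stepAt π n) (begin
    + h (suc n)                  ≡⟨ sym (height≡h n<N) ⟩
    height π (suc n)             ≡⟨ height-suc π n ⟩
    height π n + δ (stepAt π n)  ≡⟨ cong (_+ δ (stepAt π n)) (height≡h (<⇒≤ n<N)) ⟩
    + h n + δ (stepAt π n)       ∎)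
    where open ≡-Reasoning

  colourParity-suc : ∀ {n} → n < length π → colourParity (suc n) ≡ colourParity n xor isH (stepAt π n)
  colourParity-suc {n} = oddH-take-suc π n

  colourParity≡ : ∀ {n} → n ≤ length π → colourParity n ≡ odd n xor odd (h n)
  colourParity≡ {zero}  _    = refl
  colourParity≡ {suc n} n<N = begin
    colourParity (suc n)                       ≡⟨ colourParity-suc n<N ⟩
    colourParity n xor isH (stepAt π n)        ≡⟨ cong (_xor isH (stepAt π n)) (colourParity≡ (<⇒≤ n<N)) ⟩
    (odd n xor odd (h n)) xor isH (stepAt π n) ≡⟨ parity-step n (h-step n<N) ⟩
    odd (suc n) xor odd (h (suc n))            ∎
    where open ≡-Reasoning

  column : ℕ → ℤ
  column n = + colPoints true n (height π n) - + colPoints false n (height π n)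

  column≡ : ∀ {n} → n ≤ length π → column n ≡ ⟦ odd (h n) ⟧ * sign (colourParity n)
  column≡ {n} n≤N = begin
    column n
      ≡⟨ cong (λ z → + colPoints true n z - + colPoints false n z) (height≡h n≤N) ⟩
    + countCol true n (h n) - + countCol false n (h n)
      ≡⟨ countCol-balance n (h n) ⟩
    ⟦ odd (h n) ⟧ * sign (odd n xor odd (h n))
      ≡⟨ cong (λ e → ⟦ odd (h n) ⟧ * sign e) (sym (colourParity≡ n≤N)) ⟩
    ⟦ odd (h n) ⟧ * sign (colourParity n) ∎
    where open ≡-Reasoning

  surplus : ℕ → ℤ
  surplus n = + pointsUpTo true π n - + pointsUpTo false π n

  balance : ∀ {n} → n ≤ length π → + 2 * surplus n ≡ imbalance n + ⟦ odd (h n) ⟧ * sign (colourParity n)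
  balance {zero}  _    = refl
  balance {suc n} n<N = begin
    + 2 * surplus (suc n)
      ≡⟨ cong (λ z → + 2 * z) (trans surplus-suc (cong (_+ surplus n) (column≡ n<N))) ⟩
    + 2 * (c' + surplus n)
      ≡⟨ double-split c' (surplus n) ⟩
    + 2 * surplus n + c' + c'
      ≡⟨ cong (λ z → z + c' + c') (balance (<⇒≤ n<N)) ⟩
    imbalance n + c + c' + c'
      ≡⟨ cong (_+ c') (trans (ℤ.+-assoc (imbalance n) c c') (cong (λ z → imbalance n + z) odd-columns)) ⟩
    imbalance n + weight s (colourAt π n) + c'
      ≡⟨ cong (_+ c') (trans (ℤ.+-comm (imbalance n) _) (sym (imbalance-suc n))) ⟩
    imbalance (suc n) + c' ∎
    where
    open ≡-Reasoning
    s : Step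
    s = stepAt π n
    c c' : ℤ
    c = ⟦ odd (h n) ⟧ * sign (colourParity n)
    c' = ⟦ odd (h (suc n)) ⟧ * sign (colourParity (suc n))
    surplus-suc : surplus (suc n) ≡ column (suc n) + surplus n
    surplus-suc = trans (cong₂ _-_ (pos-+ (colPoints true (suc n) (height π (suc n))) (pointsUpTo true π n))
                                    (pos-+ (colPoints false (suc n) (height π (suc n))) (pointsUpTo false π n)))
                        (diff-of-sums (+ colPoints true (suc n) (height π (suc n)))
                                      (+ colPoints false (suc n) (height π (suc n)))
                                      (+ pointsUpTo true π n) (+ pointsUpTo false π n))
    odd-columns : c + c' ≡ weight s (colourAt π n)
    odd-columns = subst (λ e → c + ⟦ odd (h (suc n)) ⟧ * sign e ≡ weight s (colourOf e))
                        (sym (colourParity-suc n<N)) (odd-columns-step (colourParity n) (h-step n<N))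
    double-split : ∀ a b → + 2 * (a + b) ≡ + 2 * b + a + a
    double-split = solve-∀

proposition7p9 : (π : Path) → IsMotzkin π → RedBlueRule π →
    pointsBelow true π ≡ pointsBelow false π
proposition7p9 π motzkin rule =
  +-injective (i-j≡0⇒i≡j _ _ (*-cancelˡ-≡ (+ 2) (surplus N) 0ℤ (begin
    + 2 * surplus N
      ≡⟨ balance ≤-refl ⟩
    imbalance N + ⟦ odd (h N) ⟧ * sign (colourParity N)
      ≡⟨ cong₂ (λ i k → i + ⟦ odd k ⟧ * sign (colourParity N))
               (imbalance-vanishes N rule ≤-refl ends-at-0) (cong ∣_∣ ends-at-0) ⟩
    0ℤ ∎)))
  where
  open CountsAlong π
  open AlongMotzkinPath π motzkin
  open ≡-Reasoning
  N : ℕ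
  N = length π
  ends-at-0 : height π N ≡ 0ℤ
  ends-at-0 = trans (cong endHeight (take-all N π ≤-refl)) (proj₂ motzkin)
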